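{- Let $h,n\ge2$. If $U\le S_h\times S_n$ is a symmetry group with respect to $(h,n)$, then $O(U)=U$.
   Context: $G=S_h\times S_n$, $\mathcal P=(S_n)^h$, $G$ acting by $p^{(\varphi,\psi)}$ having $i$-th component $\psi\,p_{\varphi^{ -1}(i)}$ (products are compositions); $p^U=\{p^u:u\in U\}$. $U\le G$ is regular if $\{u\in U:p^u=p\}\subseteq S_h\times\{id\}$ for all $p$. An SPF is a map $F:\mathcal P\to S_n$ with symmetry group $G(F)=\{(\varphi,\psi)\in G:F(p^{(\varphi,\psi)})=\psi F(p)\ \forall p\}$; $U$ is a symmetry group if $U=G(F)$ for some SPF $F$ (every such group is regular). For regular $U$: $V\le_{\mathcal P}U$ means $p^V\subseteq p^U$ for all $p$; $\mathcal A(U)=\{V\le G:V\text{ regular},V\ge U,V\le_{\mathcal P}U\}$; $O(U)=\langle\mathcal A(U)\rangle$ (orbit extension). -}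

module Defs where

open import Data.Nat using (ℕ)
open import Data.Fin using (Fin)
open import Data.Product using (_×_; _,_; proj₁; proj₂; Σ)
open import Data.Fin.Permutation as P
  using (Permutation′; _⟨$⟩ʳ_; _⟨$⟩ˡ_; _∘ₚ_; flip)
open import Relation.Binary.PropositionalEquality using (_≡_)
open import Function.Bundles using (_⇔_)

Sym : ℕ → Set
Sym n = Permutation′ n

_≈ₛ_ : ∀ {n} → Sym n → Sym n → Set
σ ≈ₛ τ = ∀ i → σ ⟨$⟩ʳ i ≡ τ ⟨$⟩ʳ i

-- product = composition:  (σ · τ)(x) = σ(τ(x))
_·_ : ∀ {n} → Sym n → Sym n → Sym n
σ · τ = τ ∘ₚ σ

idₛ : ∀ {n} → Sym n
idₛ = P.id

_⁻¹ₛ : ∀ {n} → Sym n → Sym n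
σ ⁻¹ₛ = flip σ

module _ (h n : ℕ) where

  G : Set
  G = Sym h × Sym n

  _≈G_ : G → G → Set
  g ≈G g' = (proj₁ g ≈ₛ proj₁ g') × (proj₂ g ≈ₛ proj₂ g')

  _·G_ : G → G → G
  (φ , ψ) ·G (φ' , ψ') = (φ · φ') , (ψ · ψ')

  εG : G
  εG = idₛ , idₛ

  _⁻¹G : G → G
  (φ , ψ) ⁻¹G = (φ ⁻¹ₛ) , (ψ ⁻¹ₛ)

  Profile : Set
  Profile = Fin h → Sym n

  _≈P_ : Profile → Profile → Set
  p ≈P q = ∀ i → p i ≈ₛ q i

  act : Profile → G → Profile
  act p (φ , ψ) i = ψ · p (φ ⟨$⟩ˡ i)

  record Subgroup : Set₁ where
    field
      mem   : G → Set
      resp  : ∀ {g g'} → g ≈G g' → mem g → mem g'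
      one   : mem εG
      mul   : ∀ {g g'} → mem g → mem g' → mem (g ·G g')
      inv   : ∀ {g} → mem g → mem (g ⁻¹G)
  open Subgroup public

  Regular : Subgroup → Set
  Regular U = ∀ (p : Profile) (u : G) → mem U u → act p u ≈P p → proj₂ u ≈ₛ idₛ

  SPF : Set
  SPF = Σ (Profile → Sym n) λ F → ∀ {p q} → p ≈P q → F p ≈ₛ F q

  InSymGroup : SPF → G → Set
  InSymGroup (F , _) (φ , ψ) = ∀ (p : Profile) → F (act p (φ , ψ)) ≈ₛ (ψ · F p)

  IsSymmetryGroup : Subgroup → Set
  IsSymmetryGroup U = Σ SPF λ F → ∀ (g : G) → mem U g ⇔ InSymGroup F g

  _⊆_ : Subgroup → Subgroup → Set
  U ⊆ V = ∀ g → mem U g → mem V g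

  _≤𝒫_ : Subgroup → Subgroup → Set
  V ≤𝒫 U = ∀ (p : Profile) (v : G) → mem V v →
             Σ G λ u → mem U u × (act p v ≈P act p u)

  InA : Subgroup → Subgroup → Set
  InA U V = Regular V × (U ⊆ V) × (V ≤𝒫 U)

  data InO (U : Subgroup) : G → Set₁ where
    o-gen  : ∀ (V : Subgroup) → InA U V → ∀ {g} → mem V g → InO U g
    o-one  : InO U εG
    o-mul  : ∀ {g g'} → InO U g → InO U g' → InO U (g ·G g')
    o-inv  : ∀ {g} → InO U g → InO U (g ⁻¹G)
    o-resp : ∀ {g g'} → g ≈G g' → InO U g → InO U g'

module Submission where

-- If V ∈ 𝒜(U) and v ∈ V, then for each profile p some u ∈ U has p^v = p^u.  Then u⁻¹v ∈ V
-- fixes p, so regularity of V forces v and u to have the same S_n-component ψ, whence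
-- F(p^v) = F(p^u) = ψ F(p).  Thus every V ∈ 𝒜(U) lies in G(F) = U, and so does the group
-- they generate; conversely U ∈ 𝒜(U) because symmetry groups are regular.

open import Defs
open import Data.Nat using (ℕ; _≤_)
open import Data.Product using (_×_; _,_; proj₁; proj₂)
open import Data.Fin.Permutation using (_⟨$⟩ʳ_; _⟨$⟩ˡ_; inverseˡ; inverseʳ)
open import Relation.Binary.PropositionalEquality
  using (_≡_; refl; sym; trans; cong; module ≡-Reasoning)
open import Function.Bundles using (Equivalence)

module _ {n : ℕ} where

  ·-congʳ : ∀ {σ τ : Sym n} (ρ : Sym n) → σ ≈ₛ τ → (σ · ρ) ≈ₛ (τ · ρ)
  ·-congʳ ρ σ≈τ x = σ≈τ (ρ ⟨$⟩ʳ x)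

  ·-fixes⇒≈id : ∀ {ψ σ : Sym n} → (ψ · σ) ≈ₛ σ → ψ ≈ₛ idₛ
  ·-fixes⇒≈id {ψ} {σ} ψσ≈σ y = begin
    ψ ⟨$⟩ʳ y                   ≡⟨ cong (ψ ⟨$⟩ʳ_) (sym (inverseʳ σ)) ⟩
    ψ ⟨$⟩ʳ (σ ⟨$⟩ʳ (σ ⟨$⟩ˡ y)) ≡⟨ ψσ≈σ (σ ⟨$⟩ˡ y) ⟩
    σ ⟨$⟩ʳ (σ ⟨$⟩ˡ y)          ≡⟨ inverseʳ σ ⟩
    y                          ∎
    where open ≡-Reasoning

  ⁻¹·≈id⇒≈ : ∀ {σ τ : Sym n} → ((σ ⁻¹ₛ) · τ) ≈ₛ idₛ → τ ≈ₛ σ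
  ⁻¹·≈id⇒≈ {σ} {τ} σ⁻¹τ≈id y = begin
    τ ⟨$⟩ʳ y                   ≡⟨ sym (inverseʳ σ) ⟩
    σ ⟨$⟩ʳ (σ ⟨$⟩ˡ (τ ⟨$⟩ʳ y)) ≡⟨ cong (σ ⟨$⟩ʳ_) (σ⁻¹τ≈id y) ⟩
    σ ⟨$⟩ʳ y                   ∎
    where open ≡-Reasoning

module _ {h n : ℕ} where

  act-cong : ∀ {p q : Profile h n} (g : G h n) → _≈P_ h n p q →
             _≈P_ h n (act h n p g) (act h n q g)
  act-cong (φ , ψ) p≈q i y = cong (ψ ⟨$⟩ʳ_) (p≈q (φ ⟨$⟩ˡ i) y)

  act-⁻¹-cancel : ∀ (p : Profile h n) (g : G h n) →
                  _≈P_ h n (act h n (act h n p g) (_⁻¹G h n g)) p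
  act-⁻¹-cancel p (φ , ψ) i y = begin
    ψ ⟨$⟩ˡ (ψ ⟨$⟩ʳ (p (φ ⟨$⟩ˡ (φ ⟨$⟩ʳ i)) ⟨$⟩ʳ y)) ≡⟨ inverseˡ ψ ⟩
    p (φ ⟨$⟩ˡ (φ ⟨$⟩ʳ i)) ⟨$⟩ʳ y                   ≡⟨ cong (λ j → p j ⟨$⟩ʳ y) (inverseˡ φ) ⟩
    p i ⟨$⟩ʳ y                                     ∎
    where open ≡-Reasoning

  -- The action is a left action, act p (u ⁻¹ · v) = act (act p v) (u ⁻¹), definitionally.
  stabilises-⁻¹· : ∀ (p : Profile h n) (u v : G h n) →
                   _≈P_ h n (act h n p v) (act h n p u) →
                   _≈P_ h n (act h n p (_·G_ h n (_⁻¹G h n u) v)) p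
  stabilises-⁻¹· p u v pv≈pu i y =
    trans (act-cong {p = act h n p v} {q = act h n p u} (_⁻¹G h n u) pv≈pu i y)
          (act-⁻¹-cancel p u i y)

  Regular⇒image-determines-ψ :
    ∀ {V : Subgroup h n} → Regular h n V → ∀ (p : Profile h n) {u v : G h n} →
    mem V u → mem V v → _≈P_ h n (act h n p v) (act h n p u) → proj₂ v ≈ₛ proj₂ u
  Regular⇒image-determines-ψ {V} regV p {u} {v} u∈V v∈V pv≈pu =
    ⁻¹·≈id⇒≈ {σ = proj₂ u} {τ = proj₂ v}
      (regV p (_·G_ h n (_⁻¹G h n u) v) (mul V (inv V u∈V) v∈V) (stabilises-⁻¹· p u v pv≈pu))

  module _ {U : Subgroup h n} (symU : IsSymmetryGroup h n U) where

    private
      F : Profile h n → Sym n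
      F = proj₁ (proj₁ symU)

      F-cong : ∀ {p q} → _≈P_ h n p q → F p ≈ₛ F q
      F-cong = proj₂ (proj₁ symU)

      U⇒G[F] : ∀ {g} → mem U g → InSymGroup h n (proj₁ symU) g
      U⇒G[F] {g} = Equivalence.to (proj₂ symU g)

      G[F]⇒U : ∀ {g} → InSymGroup h n (proj₁ symU) g → mem U g
      G[F]⇒U {g} = Equivalence.from (proj₂ symU g)

    symmetryGroup⇒regular : Regular h n U
    symmetryGroup⇒regular p (φ , ψ) u∈U pu≈p =
      ·-fixes⇒≈id {ψ = ψ} {σ = F p} λ x →
        trans (sym (U⇒G[F] u∈U p x)) (F-cong pu≈p x)

    InA⇒⊆symmetryGroup : ∀ (V : Subgroup h n) → InA h n U V → _⊆_ h n V U
    InA⇒⊆symmetryGroup V (regV , U⊆V , V≤𝒫U) v v∈V = G[F]⇒U λ p x →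
      let (u , u∈U , pv≈pu) = V≤𝒫U p v v∈V
          ψv≈ψu = Regular⇒image-determines-ψ {V = V} regV p (U⊆V u u∈U) v∈V pv≈pu
      in trans (F-cong pv≈pu x)
           (trans (U⇒G[F] u∈U p x)
                  (sym (·-congʳ {σ = proj₂ v} {τ = proj₂ u} (F p) ψv≈ψu x)))

  InA-refl : ∀ {U : Subgroup h n} → Regular h n U → InA h n U U
  InA-refl regU = regU , (λ _ g∈U → g∈U) , λ _ g g∈U → g , g∈U , λ _ _ → refl

  InO-least : ∀ {U W : Subgroup h n} → (∀ V → InA h n U V → _⊆_ h n V W) →
              ∀ g → InO h n U g → mem W g
  InO-least {U} {W} A⊆W = go
    where
    go : ∀ g → InO h n U g → mem W g
    go g (o-gen V V∈A g∈V) = A⊆W V V∈A g g∈V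
    go _ o-one             = one W
    go _ (o-mul g∈O g'∈O)  = mul W (go _ g∈O) (go _ g'∈O)
    go _ (o-inv g∈O)       = inv W (go _ g∈O)
    go _ (o-resp g≈g' g∈O) = resp W g≈g' (go _ g∈O)

corollary51 : (h n : ℕ) → 2 ≤ h → 2 ≤ n → (U : Subgroup h n) → IsSymmetryGroup h n U →
    (∀ g → InO h n U g → mem U g) × (∀ g → mem U g → InO h n U g)
corollary51 h n _ _ U symU =
  InO-least {U = U} {W = U} (InA⇒⊆symmetryGroup {U = U} symU) ,
  λ g → o-gen U (InA-refl {U = U} (symmetryGroup⇒regular {U = U} symU))
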